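{- The monoid $\mathcal{L}$ of Left dead ends is pocancellative: for all Left dead ends $G,H,J$, if $G+J\geq H+J$ then $G\geq H$.
   Context: All games are short partizan combinatorial game forms; $G+H$ is the disjunctive sum. Play is misère (a player unable to move wins). Misère outcome classes are ordered $\mathscr L>\mathscr P>\mathscr R$ and $\mathscr L>\mathscr N>\mathscr R$ ($\mathscr P,\mathscr N$ incomparable); $G\geq H$ means that for every game $X$ the misère outcome of $G+X$ is $\geq$ that of $H+X$, and $G=H$ means $G\ge H$ and $H\ge G$. A Left dead end is a game no subposition of which (including itself) has a Left option. The Left dead ends form a commutative monoid $\mathcal{L}$ under $+$ with identity $0=\{\cdot\mid\cdot\}$, partially ordered by $\geq$. -}

module Defs where

open import Data.Nat using (ℕ; zero; suc) renaming (_+_ to _+ℕ_)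
open import Data.Fin using (Fin; zero; suc; splitAt)
open import Data.Sum using (_⊎_; inj₁; inj₂; [_,_]′)
open import Data.Bool using (Bool; true; false; _∨_; not)
open import Data.Product using (_×_)
open import Data.Unit using (⊤)
open import Relation.Binary.PropositionalEquality using (_≡_)

data Game : Set where
  game : (m : ℕ) → (Fin m → Game) → (n : ℕ) → (Fin n → Game) → Game

-- Disjunctive sum  G + H = { G^L + H , G + H^L | G^R + H , G + H^R }
infixl 6 _+_
_+_ : Game → Game → Game
game m GL n GR + game m' HL n' HR =
  game (m +ℕ m')
       (λ i → [ (λ a → GL a + game m' HL n' HR) , (λ b → game m GL n GR + HL b) ]′ (splitAt m i))
       (n +ℕ n')
       (λ i → [ (λ a → GR a + game m' HL n' HR) , (λ b → game m GL n GR + HR b) ]′ (splitAt n i))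

anyFin : (k : ℕ) → (Fin k → Bool) → Bool
anyFin zero f = false
anyFin (suc k) f = f zero ∨ anyFin k (λ i → f (suc i))

isZero : ℕ → Bool
isZero zero = true
isZero (suc _) = false

-- Misère play: a player unable to move wins.
-- leftWinsFirst G : Left, moving first in G, has a winning strategy.
-- rightWinsFirst G : Right, moving first in G, has a winning strategy.
leftWinsFirst  : Game → Bool
rightWinsFirst : Game → Bool
leftWinsFirst (game m GL n GR) = isZero m ∨ anyFin m (λ i → not (rightWinsFirst (GL i)))
rightWinsFirst (game m GL n GR) = isZero n ∨ anyFin n (λ j → not (leftWinsFirst (GR j)))

data Outcome : Set where
  𝓛 𝓝 𝓟 𝓡 : Outcome

outcome : Game → Outcome
outcome G with leftWinsFirst G | rightWinsFirst G
... | true  | false = 𝓛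
... | true  | true  = 𝓝
... | false | false = 𝓟
... | false | true  = 𝓡

data _≥o_ : Outcome → Outcome → Set where
  refl≥ : ∀ {o} → o ≥o o
  L≥P : 𝓛 ≥o 𝓟
  L≥N : 𝓛 ≥o 𝓝
  L≥R : 𝓛 ≥o 𝓡
  P≥R : 𝓟 ≥o 𝓡
  N≥R : 𝓝 ≥o 𝓡

infix 4 _≥_
_≥_ : Game → Game → Set
G ≥ H = (X : Game) → outcome (G + X) ≥o outcome (H + X)

IsLeftDeadEnd : Game → Set
IsLeftDeadEnd (game m GL n GR) = (m ≡ 0) × ((j : Fin n) → IsLeftDeadEnd (GR j))

{-# OPTIONS --safe #-}
module Submission where

-- On Left dead ends, G ≥ H is equivalent to the recursive relation G ⊒ H: if G is a Right end then
-- so is H, and every Right option of G is ⊒ some Right option of H. Sufficiency is strategy copying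
-- in G + X against H + X. Conversely, if G ⋣ H, some X lets Right, moving first, win G + X but not
-- H + X: either G is a Right end, H is not, and X = 0; or some G′ ∈ᴿ G is separated from each Right
-- option Hⱼ of H by some Xⱼ, and X = {n, X₁, …, Xₖ | 0} works, n being the length of a run of Right
-- moves from G′ to a Right end.
--
-- It remains to cancel J from G + J ⊒ H + J. A move to G′ + J is answered by H′ + J, and we recurse,
-- or by H + J′; then G′ + J′ is answered in H + J′, and so on, until an answer H′ + J″ occurs, which
-- J being finite forces. That H is a Right end when G is follows by comparing lengths of Right runs.

open import Defs
open import Data.Bool using (Bool; true; false; T; not)
open import Data.Bool.Properties using (T-∨)
open import Data.Empty using (⊥-elim)
open import Data.Fin using (Fin; zero; suc; splitAt; _↑ˡ_; _↑ʳ_)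
open import Data.Fin.Properties using (any?; all?; ¬∀⟶∃¬; ⊎⇔∃)
open import Data.Nat using (ℕ; zero; suc; _<_; s≤s) renaming (_+_ to _+ℕ_)
open import Data.Nat.Induction using (<-rec)
open import Data.Nat.Properties using (m≤n+m; +-suc)
open import Data.Product using (∃; ∃₂; _×_; _,_; proj₁; proj₂)
open import Data.Sum using (_⊎_; inj₁; inj₂)
open import Data.Sum.Function.Propositional using (_⊎-⇔_)
open import Data.Unit using (tt)
open import Data.Vec.Functional using ([]; _∷_)
open import Data.Vec.Functional.Properties using (lookup-++ˡ; lookup-++ʳ)
open import Function using (_∘_)
open import Function.Bundles using (_⇔_; mk⇔; Equivalence)
open import Function.Construct.Composition using (_⇔-∘_)
open import Function.Construct.Identity using (⇔-id)
open import Relation.Nullary using (¬_; Dec; yes; no; _×-dec_; _→-dec_)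
open import Relation.Nullary.Decidable using (map′)
open import Relation.Binary.PropositionalEquality using (_≡_; refl; subst)

open Equivalence using (to; from)

T-anyFin : ∀ k (f : Fin k → Bool) → T (anyFin k f) ⇔ ∃ λ i → T (f i)
T-anyFin zero    f = mk⇔ (λ ()) λ ()
T-anyFin (suc k) f = (⊎⇔∃ ⇔-∘ (⇔-id _ ⊎-⇔ T-anyFin k (f ∘ suc))) ⇔-∘ T-∨

T-not : ∀ {b} → T (not b) ⇔ (¬ T b)
T-not {true}  = mk⇔ (λ ()) (λ ¬t → ¬t tt)
T-not {false} = mk⇔ (λ _ ()) (λ _ → tt)

infix 4 _∈ᴸ_ _∈ᴿ_

data _∈ᴸ_ : Game → Game → Set where
  leftOption : ∀ {m GL n GR} i → GL i ∈ᴸ game m GL n GR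

data _∈ᴿ_ : Game → Game → Set where
  rightOption : ∀ {m GL n GR} j → GR j ∈ᴿ game m GL n GR

IsLeftEnd IsRightEnd : Game → Set
IsLeftEnd  G = ∀ {G′} → ¬ G′ ∈ᴸ G
IsRightEnd G = ∀ {G′} → ¬ G′ ∈ᴿ G

isRightEnd? : ∀ G → Dec (IsRightEnd G)
isRightEnd? (game _ _ zero    _) = yes λ { (rightOption ()) }
isRightEnd? (game _ _ (suc _) _) = no λ end → end (rightOption zero)

anyRightOption? : ∀ {P : Game → Set} H → (∀ H′ → Dec (P H′)) → Dec (∃ λ H′ → H′ ∈ᴿ H × P H′)
anyRightOption? (game _ _ _ HR) P? =
  map′ (λ (j , pj) → HR j , rightOption j , pj) (λ { (_ , rightOption j , pj) → j , pj })
       (any? (P? ∘ HR))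

data SumOption (_∈_ : Game → Game → Set) (G H : Game) : Game → Set where
  inFirst  : ∀ {G′} → G′ ∈ G → SumOption _∈_ G H (G′ + H)
  inSecond : ∀ {H′} → H′ ∈ H → SumOption _∈_ G H (G + H′)

∈ᴸ-+⁺ : ∀ {G H K} → SumOption _∈ᴸ_ G H K → K ∈ᴸ G + H
∈ᴸ-+⁺ {G@(game m GL _ _)} {H@(game m′ HL _ _)} (inFirst (leftOption i)) =
  subst (_∈ᴸ G + H) (lookup-++ˡ (λ a → GL a + H) (λ b → G + HL b) i) (leftOption (i ↑ˡ m′))
∈ᴸ-+⁺ {G@(game m GL _ _)} {H@(game m′ HL _ _)} (inSecond (leftOption i)) =
  subst (_∈ᴸ G + H) (lookup-++ʳ (λ a → GL a + H) (λ b → G + HL b) i) (leftOption (m ↑ʳ i))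

∈ᴿ-+⁺ : ∀ {G H K} → SumOption _∈ᴿ_ G H K → K ∈ᴿ G + H
∈ᴿ-+⁺ {G@(game _ _ n GR)} {H@(game _ _ n′ HR)} (inFirst (rightOption j)) =
  subst (_∈ᴿ G + H) (lookup-++ˡ (λ a → GR a + H) (λ b → G + HR b) j) (rightOption (j ↑ˡ n′))
∈ᴿ-+⁺ {G@(game _ _ n GR)} {H@(game _ _ n′ HR)} (inSecond (rightOption j)) =
  subst (_∈ᴿ G + H) (lookup-++ʳ (λ a → GR a + H) (λ b → G + HR b) j) (rightOption (n ↑ʳ j))

∈ᴸ-+⁻ : ∀ G H {K} → K ∈ᴸ G + H → SumOption _∈ᴸ_ G H K
∈ᴸ-+⁻ (game m _ _ _) (game _ _ _ _) (leftOption k) with splitAt m k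
... | inj₁ i = inFirst (leftOption i)
... | inj₂ i = inSecond (leftOption i)

∈ᴿ-+⁻ : ∀ G H {K} → K ∈ᴿ G + H → SumOption _∈ᴿ_ G H K
∈ᴿ-+⁻ (game _ _ n _) (game _ _ _ _) (rightOption k) with splitAt n k
... | inj₁ j = inFirst (rightOption j)
... | inj₂ j = inSecond (rightOption j)

isLeftEnd-+ : ∀ {G H} → IsLeftEnd G → IsLeftEnd H → IsLeftEnd (G + H)
isLeftEnd-+ {G} {H} endG endH p with ∈ᴸ-+⁻ G H p
... | inFirst  q = endG q
... | inSecond q = endH q

isRightEnd-+ : ∀ {G H} → IsRightEnd G → IsRightEnd H → IsRightEnd (G + H)
isRightEnd-+ {G} {H} endG endH p with ∈ᴿ-+⁻ G H p
... | inFirst  q = endG q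
... | inSecond q = endH q

isLeftEnd-+⁻ʳ : ∀ {G H} → IsLeftEnd (G + H) → IsLeftEnd H
isLeftEnd-+⁻ʳ end q = end (∈ᴸ-+⁺ (inSecond q))

isRightEnd-+⁻ : ∀ {G H} → IsRightEnd (G + H) → IsRightEnd G × IsRightEnd H
isRightEnd-+⁻ end = (λ p → end (∈ᴿ-+⁺ (inFirst p))) , (λ q → end (∈ᴿ-+⁺ (inSecond q)))

isLeftDeadEnd-isLeftEnd : ∀ {G} → IsLeftDeadEnd G → IsLeftEnd G
isLeftDeadEnd-isLeftEnd (refl , _) (leftOption ())

isLeftDeadEnd-∈ᴿ : ∀ {G G′} → IsLeftDeadEnd G → G′ ∈ᴿ G → IsLeftDeadEnd G′
isLeftDeadEnd-∈ᴿ (_ , dead) (rightOption j) = dead j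

isLeftDeadEnd-intro : ∀ {G} → IsLeftEnd G → (∀ {G′} → G′ ∈ᴿ G → IsLeftDeadEnd G′) → IsLeftDeadEnd G
isLeftDeadEnd-intro {game zero    _ _ _} _   dead = refl , λ j → dead (rightOption j)
isLeftDeadEnd-intro {game (suc _) _ _ _} end _    = ⊥-elim (end (leftOption zero))

isLeftDeadEnd-+ : ∀ {G H} → IsLeftDeadEnd G → IsLeftDeadEnd H → IsLeftDeadEnd (G + H)
isLeftDeadEnd-+-∈ᴿ : ∀ {G H K} → IsLeftDeadEnd G → IsLeftDeadEnd H → K ∈ᴿ G + H → IsLeftDeadEnd K

isLeftDeadEnd-+ dG dH =
  isLeftDeadEnd-intro (isLeftEnd-+ (isLeftDeadEnd-isLeftEnd dG) (isLeftDeadEnd-isLeftEnd dH))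
                      (isLeftDeadEnd-+-∈ᴿ dG dH)

-- Matching q against rightOption makes the option a visible subterm, as the termination checker needs.
isLeftDeadEnd-+-∈ᴿ {G} {H} dG dH p with ∈ᴿ-+⁻ G H p
... | inFirst  q@(rightOption _) = isLeftDeadEnd-+ (isLeftDeadEnd-∈ᴿ dG q) dH
... | inSecond q@(rightOption _) = isLeftDeadEnd-+ dG (isLeftDeadEnd-∈ᴿ dH q)

-- Opaque so that the game can be inferred from a type LeftWins G or RightWins G.
opaque
  LeftWins RightWins : Game → Set
  LeftWins  G = T (leftWinsFirst G)
  RightWins G = T (rightWinsFirst G)

  leftWins-end : ∀ {G} → IsLeftEnd G → LeftWins G
  leftWins-end {game zero    _ _ _} _   = tt
  leftWins-end {game (suc _) _ _ _} end = ⊥-elim (end (leftOption zero))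

  rightWins-end : ∀ {G} → IsRightEnd G → RightWins G
  rightWins-end {game _ _ zero    _} _   = tt
  rightWins-end {game _ _ (suc _) _} end = ⊥-elim (end (rightOption zero))

  leftWins-move : ∀ {G G′} → G′ ∈ᴸ G → ¬ RightWins G′ → LeftWins G
  leftWins-move (leftOption {m} {GL} i) ¬rw =
    from T-∨ (inj₂ (from (T-anyFin m (not ∘ rightWinsFirst ∘ GL)) (i , from T-not ¬rw)))

  rightWins-move : ∀ {G G′} → G′ ∈ᴿ G → ¬ LeftWins G′ → RightWins G
  rightWins-move (rightOption {n = n} {GR} j) ¬lw =
    from T-∨ (inj₂ (from (T-anyFin n (not ∘ leftWinsFirst ∘ GR)) (j , from T-not ¬lw)))

  leftWins-cases : ∀ {G} → LeftWins G → IsLeftEnd G ⊎ ∃ λ G′ → G′ ∈ᴸ G × ¬ RightWins G′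
  leftWins-cases {game zero    _  _ _} _  = inj₁ λ { (leftOption ()) }
  leftWins-cases {game (suc m) GL _ _} lw =
    let i , ¬rw = to (T-anyFin (suc m) (not ∘ rightWinsFirst ∘ GL)) lw
    in  inj₂ (GL i , leftOption i , to T-not ¬rw)

  rightWins-cases : ∀ {G} → RightWins G → IsRightEnd G ⊎ ∃ λ G′ → G′ ∈ᴿ G × ¬ LeftWins G′
  rightWins-cases {game _ _ zero    _ } _  = inj₁ λ { (rightOption ()) }
  rightWins-cases {game _ _ (suc n) GR} rw =
    let j , ¬lw = to (T-anyFin (suc n) (not ∘ leftWinsFirst ∘ GR)) rw
    in  inj₂ (GR j , rightOption j , to T-not ¬lw)

  outcome-≥ : ∀ {G H} → (LeftWins H → LeftWins G) → (RightWins G → RightWins H) →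
              outcome G ≥o outcome H
  outcome-≥ {G} {H} with leftWinsFirst G | rightWinsFirst G | leftWinsFirst H | rightWinsFirst H
  ... | true  | false | true  | false = λ _ _ → refl≥
  ... | true  | false | true  | true  = λ _ _ → L≥N
  ... | true  | false | false | false = λ _ _ → L≥P
  ... | true  | false | false | true  = λ _ _ → L≥R
  ... | true  | true  | true  | true  = λ _ _ → refl≥
  ... | true  | true  | false | true  = λ _ _ → N≥R
  ... | false | false | false | false = λ _ _ → refl≥
  ... | false | false | false | true  = λ _ _ → P≥R
  ... | false | true  | false | true  = λ _ _ → refl≥
  ... | _     | true  | _     | false = λ _ rw → ⊥-elim (rw _)
  ... | false | _     | true  | _     = λ lw _ → ⊥-elim (lw _)

  ≥o-rightWins : ∀ {G H} → outcome G ≥o outcome H → RightWins G → RightWins H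
  ≥o-rightWins {G} {H} with leftWinsFirst G | rightWinsFirst G | leftWinsFirst H | rightWinsFirst H
  ... | _     | _     | _     | true  = λ _ _ → tt
  ... | _     | false | _     | _     = λ _ ()
  ... | true  | true  | true  | false = λ ()
  ... | true  | true  | false | false = λ ()
  ... | false | true  | true  | false = λ ()
  ... | false | true  | false | false = λ ()

rightLoses : ∀ {G} → ¬ IsRightEnd G → (∀ {G′} → G′ ∈ᴿ G → LeftWins G′) → ¬ RightWins G
rightLoses ¬end lw rw with rightWins-cases rw
... | inj₁ end           = ¬end end
... | inj₂ (_ , p , ¬lw) = ¬lw (lw p)

leftWins-deadEnd-+⁻ : ∀ {D X} → IsLeftDeadEnd D → LeftWins (D + X) →
                      IsLeftEnd X ⊎ ∃ λ X′ → X′ ∈ᴸ X × ¬ RightWins (D + X′)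
leftWins-deadEnd-+⁻ {D} {X} dD lw with leftWins-cases lw
... | inj₁ end = inj₁ (isLeftEnd-+⁻ʳ end)
... | inj₂ (_ , p , ¬rw) with ∈ᴸ-+⁻ D X p
...   | inFirst  q = ⊥-elim (isLeftDeadEnd-isLeftEnd dD q)
...   | inSecond q = inj₂ (_ , q , ¬rw)

leftLoses-deadEnd-+ : ∀ {D X} → IsLeftDeadEnd D → ¬ IsLeftEnd X →
                      (∀ {X′} → X′ ∈ᴸ X → RightWins (D + X′)) → ¬ LeftWins (D + X)
leftLoses-deadEnd-+ dD ¬end rw lw with leftWins-deadEnd-+⁻ dD lw
... | inj₁ end           = ¬end end
... | inj₂ (_ , q , ¬rw) = ¬rw (rw q)

infix 4 _⊒_ _⊒?_

_⊒_ : Game → Game → Set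
G@(game _ _ _ GR) ⊒ H = (IsRightEnd G → IsRightEnd H) × (∀ i → ∃ λ H′ → H′ ∈ᴿ H × GR i ⊒ H′)

⊒-intro : ∀ {G H} → (IsRightEnd G → IsRightEnd H) →
          (∀ {G′} → G′ ∈ᴿ G → ∃ λ H′ → H′ ∈ᴿ H × G′ ⊒ H′) → G ⊒ H
⊒-intro {game _ _ _ _} end match = end , λ i → match (rightOption i)

⊒-end : ∀ {G H} → G ⊒ H → IsRightEnd G → IsRightEnd H
⊒-end {game _ _ _ _} = proj₁

⊒-option : ∀ {G H G′} → G ⊒ H → G′ ∈ᴿ G → ∃ λ H′ → H′ ∈ᴿ H × G′ ⊒ H′
⊒-option (_ , match) (rightOption i) = match i

_⊒?_ : ∀ G H → Dec (G ⊒ H)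
G@(game _ _ _ GR) ⊒? H =
  (isRightEnd? G →-dec isRightEnd? H) ×-dec all? λ i → anyRightOption? H (GR i ⊒?_)

⊒-leftWins : ∀ X {G H} → IsLeftDeadEnd G → IsLeftDeadEnd H → G ⊒ H →
             LeftWins (H + X) → LeftWins (G + X)
⊒-rightWins : ∀ X {G H} → IsLeftDeadEnd G → IsLeftDeadEnd H → G ⊒ H →
              RightWins (G + X) → RightWins (H + X)

⊒-leftWins X dG dH G⊒H lw with leftWins-deadEnd-+⁻ dH lw
... | inj₁ endX = leftWins-end (isLeftEnd-+ (isLeftDeadEnd-isLeftEnd dG) endX)
... | inj₂ (X′ , p@(leftOption _) , ¬rw) =
  leftWins-move (∈ᴸ-+⁺ (inSecond p)) (¬rw ∘ ⊒-rightWins X′ dG dH G⊒H)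

⊒-rightWins X {G} dG dH G⊒H rw with rightWins-cases rw
... | inj₁ end =
  let endG , endX = isRightEnd-+⁻ end in rightWins-end (isRightEnd-+ (⊒-end G⊒H endG) endX)
... | inj₂ (_ , p , ¬lw) with ∈ᴿ-+⁻ G X p
...   | inFirst q@(rightOption _) =
  let _ , q′ , G′⊒H′ = ⊒-option G⊒H q in
  rightWins-move (∈ᴿ-+⁺ (inFirst q′))
    (¬lw ∘ ⊒-leftWins X (isLeftDeadEnd-∈ᴿ dG q) (isLeftDeadEnd-∈ᴿ dH q′) G′⊒H′)
...   | inSecond q@(rightOption _) =
  rightWins-move (∈ᴿ-+⁺ (inSecond q)) (¬lw ∘ ⊒-leftWins _ dG dH G⊒H)

⊒⇒≥ : ∀ {G H} → IsLeftDeadEnd G → IsLeftDeadEnd H → G ⊒ H → G ≥ H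
⊒⇒≥ dG dH G⊒H X = outcome-≥ (⊒-leftWins X dG dH G⊒H) (⊒-rightWins X dG dH G⊒H)

data RightRun : Game → ℕ → Set where
  stop : ∀ {G} → IsRightEnd G → RightRun G 0
  step : ∀ {G G′ ℓ} → G′ ∈ᴿ G → RightRun G′ ℓ → RightRun G (suc ℓ)

rightRun-exists : ∀ G → ∃ (RightRun G)
rightRun-exists (game _ _ zero    _)  = 0 , stop λ { (rightOption ()) }
rightRun-exists (game _ _ (suc _) GR) =
  let ℓ , run = rightRun-exists (GR zero) in suc ℓ , step (rightOption zero) run

⊒-rightRun : ∀ {G H ℓ} → G ⊒ H → RightRun G ℓ → RightRun H ℓ
⊒-rightRun G⊒H (stop end)   = stop (⊒-end G⊒H end)
⊒-rightRun G⊒H (step p run) = let _ , q , G′⊒H′ = ⊒-option G⊒H p in step q (⊒-rightRun G′⊒H′ run)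

rightRun-+ : ∀ {G H a b} → RightRun G a → RightRun H b → RightRun (G + H) (a +ℕ b)
rightRun-+ (stop endG) (stop endH)  = stop (isRightEnd-+ endG endH)
rightRun-+ (stop endG) (step q run) = step (∈ᴿ-+⁺ (inSecond q)) (rightRun-+ (stop endG) run)
rightRun-+ (step p run) runH        = step (∈ᴿ-+⁺ (inFirst p)) (rightRun-+ run runH)

rightRun-+⁻ : ∀ {G H ℓ} → RightRun (G + H) ℓ →
              ∃₂ λ a b → a +ℕ b ≡ ℓ × RightRun G a × RightRun H b
rightRun-+⁻ (stop end) = let endG , endH = isRightEnd-+⁻ end in 0 , 0 , refl , stop endG , stop endH
rightRun-+⁻ {G} {H} (step p run) with ∈ᴿ-+⁻ G H p
... | inFirst q with rightRun-+⁻ run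
...   | a , b , refl , runG , runH = suc a , b , refl , step q runG , runH
rightRun-+⁻ (step p run) | inSecond q with rightRun-+⁻ run
...   | a , b , refl , runG , runH = a , suc b , +-suc a b , runG , step q runH

integer : ℕ → Game
integer zero    = game 0 [] 0 []
integer (suc n) = game 1 (λ _ → integer n) 0 []

rightWins-+integer : ∀ {G ℓ} → IsLeftDeadEnd G → RightRun G ℓ → RightWins (G + integer ℓ)
rightWins-+integer dG (stop end)   = rightWins-end (isRightEnd-+ end λ { (rightOption ()) })
rightWins-+integer dG (step p run) =
  rightWins-move (∈ᴿ-+⁺ (inFirst p))
    (leftLoses-deadEnd-+ dG′ (λ end → end (leftOption zero))
      λ { (leftOption zero) → rightWins-+integer dG′ run ; (leftOption (suc ())) })
  where
  dG′ = isLeftDeadEnd-∈ᴿ dG p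

Distinguisher : Game → Game → Set
Distinguisher G H = ∃ λ X → RightWins (G + X) × ¬ RightWins (H + X)

distinguisher-rightOption : ∀ {A A′ m BL n BR} → A′ ∈ᴿ A → IsLeftDeadEnd A′ →
                            IsLeftDeadEnd (game m BL n BR) → (∀ j → Distinguisher A′ (BR j)) →
                            Distinguisher A (game m BL n BR)
distinguisher-rightOption {_} {A′} {m} {BL} {n} {BR} p dA′ dB distinguishers =
  X , rightWins-move (∈ᴿ-+⁺ (inFirst p)) leftLosesA′+X , rightLoses ¬endB+X leftWinsB+X
  where
  B   = game m BL n BR
  run = rightRun-exists A′
  X   = game (suc n) (integer (proj₁ run) ∷ (proj₁ ∘ distinguishers)) 1 (λ _ → integer 0)

  leftLosesA′+X : ¬ LeftWins (A′ + X)
  leftLosesA′+X = leftLoses-deadEnd-+ dA′ (λ end → end (leftOption zero)) λ where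
    (leftOption zero)    → rightWins-+integer dA′ (proj₂ run)
    (leftOption (suc j)) → proj₁ (proj₂ (distinguishers j))

  ¬endB+X : ¬ IsRightEnd (B + X)
  ¬endB+X end = end (∈ᴿ-+⁺ (inSecond (rightOption zero)))

  leftWinsB+X : ∀ {K} → K ∈ᴿ B + X → LeftWins K
  leftWinsB+X q with ∈ᴿ-+⁻ B X q
  ... | inFirst (rightOption j) =
    leftWins-move (∈ᴸ-+⁺ (inSecond (leftOption (suc j)))) (proj₂ (proj₂ (distinguishers j)))
  ... | inSecond (rightOption zero) =
    leftWins-end (isLeftEnd-+ (isLeftDeadEnd-isLeftEnd dB) λ { (leftOption ()) })

distinguish : ∀ {A B} → IsLeftDeadEnd A → IsLeftDeadEnd B → ¬ A ⊒ B → Distinguisher A B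
distinguish {game _ _ zero _} {game _ _ zero _} _ _ A⋣B =
  ⊥-elim (A⋣B ((λ _ → λ { (rightOption ()) }) , λ ()))
distinguish {A@(game _ _ zero _)} {B@(game _ _ (suc _) _)} _ dB _ =
  integer 0 , rightWins-end (isRightEnd-+ {A} (λ { (rightOption ()) }) λ { (rightOption ()) }) ,
  rightLoses (λ end → end (∈ᴿ-+⁺ (inFirst (rightOption zero)))) leftWinsB+0
  where
  leftWinsB+0 : ∀ {K} → K ∈ᴿ B + integer 0 → LeftWins K
  leftWinsB+0 q with ∈ᴿ-+⁻ B (integer 0) q
  ... | inFirst q′ =
    leftWins-end (isLeftEnd-+ (isLeftDeadEnd-isLeftEnd (isLeftDeadEnd-∈ᴿ dB q′)) λ { (leftOption ()) })
  ... | inSecond (rightOption ())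
distinguish {A@(game _ _ (suc n) AR)} {B@(game _ _ _ BR)} dA dB A⋣B =
  let i , unmatched = ¬∀⟶∃¬ (suc n) _ (λ i → anyRightOption? B (AR i ⊒?_))
                        (λ match → A⋣B ((λ end → ⊥-elim (end (rightOption zero))) , match))
  in distinguisher-rightOption (rightOption i) (proj₂ dA i) dB
       λ j → distinguish (proj₂ dA i) (proj₂ dB j) λ Aᵢ⊒Bⱼ → unmatched (BR j , rightOption j , Aᵢ⊒Bⱼ)

≥⇒⊒ : ∀ {G H} → IsLeftDeadEnd G → IsLeftDeadEnd H → G ≥ H → G ⊒ H
≥⇒⊒ {G} {H} dG dH G≥H with G ⊒? H
... | yes G⊒H = G⊒H
... | no  G⋣H =
  let X , rightWinsG+X , ¬rightWinsH+X = distinguish dG dH G⋣H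
  in  ⊥-elim (¬rightWinsH+X (≥o-rightWins (G≥H X) rightWinsG+X))

-- A Right run of J of length ℓ gives one of G + J, hence one of H + J; unless H is a Right end,
-- the part of the latter played in J is shorter than ℓ.
⊒-cancel-isRightEnd : ∀ {G H J} → IsRightEnd G → G + J ⊒ H + J → IsRightEnd H
⊒-cancel-isRightEnd {G} {H} {J} endG G+J⊒H+J =
  <-rec (λ ℓ → RightRun J ℓ → IsRightEnd H) shorten _ (proj₂ (rightRun-exists J))
  where
  shorten : ∀ ℓ → (∀ {ℓ′} → ℓ′ < ℓ → RightRun J ℓ′ → IsRightEnd H) → RightRun J ℓ → IsRightEnd H
  shorten ℓ shorter runJ with rightRun-+⁻ {H} (⊒-rightRun G+J⊒H+J (rightRun-+ (stop endG) runJ))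
  ... | zero  , _ , _    , stop endH , _     = endH
  ... | suc a , b , refl , _         , runJ′ = shorter (s≤s (m≤n+m b a)) runJ′

⊒-cancelʳ : ∀ J {G H} → G + J ⊒ H + J → G ⊒ H
⊒-cancelʳ-option : ∀ J {G H G′} → G + J ⊒ H + J → G′ ∈ᴿ G → ∃ λ H′ → H′ ∈ᴿ H × G′ ⊒ H′
⊒-cancel-rightOption : ∀ {K K′ G H} → K′ ∈ᴿ K → G + K ⊒ H + K′ → ∃ λ H′ → H′ ∈ᴿ H × G ⊒ H′

⊒-cancelʳ J G+J⊒H+J =
  ⊒-intro (λ endG → ⊒-cancel-isRightEnd endG G+J⊒H+J) (⊒-cancelʳ-option J G+J⊒H+J)

⊒-cancelʳ-option J {H = H} G+J⊒H+J p@(rightOption _)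
  with ⊒-option G+J⊒H+J (∈ᴿ-+⁺ (inFirst p))
... | _ , q , G′+J⊒K with ∈ᴿ-+⁻ H J q
...   | inFirst  q′ = _ , q′ , ⊒-cancelʳ J G′+J⊒K
...   | inSecond q′ = ⊒-cancel-rightOption q′ G′+J⊒K

⊒-cancel-rightOption {K′ = K′} {H = H} p@(rightOption _) G+K⊒H+K′
  with ⊒-option G+K⊒H+K′ (∈ᴿ-+⁺ (inSecond p))
... | _ , q , G+K′⊒L with ∈ᴿ-+⁻ H K′ q
...   | inFirst  q′ = _ , q′ , ⊒-cancelʳ K′ G+K′⊒L
...   | inSecond q′ = ⊒-cancel-rightOption q′ G+K′⊒L

mainTheorem2 : (G H J : Game) → IsLeftDeadEnd G → IsLeftDeadEnd H → IsLeftDeadEnd J →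
                 G + J ≥ H + J → G ≥ H
mainTheorem2 G H J dG dH dJ G+J≥H+J =
  ⊒⇒≥ dG dH (⊒-cancelʳ J (≥⇒⊒ (isLeftDeadEnd-+ dG dJ) (isLeftDeadEnd-+ dH dJ) G+J≥H+J))
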